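{- Let $N\in\mathbb{N}$ and $a\in\mathbb{Z}$ with $\gcd(N,a)=1$. If $N=X^2+Y^2$ is solvable in integers $X,Y$, then $\left(\frac{a^2}{N}\right)_4=\left(\frac{a}{N}\right)_2$.
   Context: For $k\in\mathbb{N}_0$, a prime $p$ and $a\in\mathbb{Z}$ with $p\nmid a$, $\left(\frac{a}{p}\right)_{2^k}=1$ if there is $x\in\mathbb{Z}$ with $x^{2^k}\equiv a \pmod p$, and $-1$ otherwise; for $n=p_1\cdots p_l$ (primes not necessarily distinct) with $\gcd(n,a)=1$, $\left(\frac{a}{n}\right)_{2^k}:=\prod_i\left(\frac{a}{p_i}\right)_{2^k}$. -}

module Defs where

open import Data.Nat using (ℕ)
open import Data.Integer using (ℤ; +_; -_; _*_; _-_; _^_)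
open import Data.Integer.Divisibility using (_∣_)
open import Data.Nat.Primality using (Prime)
open import Data.List using (List; []; _∷_)
open import Data.Product using (∃; _×_)
open import Data.Sum using (_⊎_)
open import Relation.Nullary using (¬_)
open import Relation.Binary.PropositionalEquality using (_≡_)

IsPowerResidue : ℕ → ℕ → ℤ → Set
IsPowerResidue k p a = ∃ λ (x : ℤ) → (+ p) ∣ ((x ^ (2 Data.Nat.^ k)) - a)

PrimeSymbol : ℕ → ℤ → ℕ → ℤ → Set
PrimeSymbol k a p s =
  (IsPowerResidue k p a × s ≡ + 1) ⊎ (¬ IsPowerResidue k p a × s ≡ - (+ 1))

-- (a/n)_{2^k} = s, where n = p_1 ⋯ p_l is given by the list of primes ps:
-- the product over i of (a/p_i)_{2^k}
Symbol : ℕ → ℤ → List ℕ → ℤ → Set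
Symbol k a []       s = s ≡ + 1
Symbol k a (p ∷ ps) s =
  ∃ λ (sp : ℤ) → ∃ λ (t : ℤ) → PrimeSymbol k a p sp × Symbol k a ps t × s ≡ sp * t

{-# OPTIONS --safe #-}
-- Let p be a prime for which -1 is a square, say i² ≡ -1 (mod p).  If x⁴ ≡ a² then
-- p divides (x² - a)(x² + a), so a ≡ x² or a ≡ (ix)²; hence a² is a fourth power
-- mod p exactly when a is a square mod p, and the two symbols agree at p.
-- Now let N = X² + Y².  If no prime factor p of N divides X, then -1 ≡ (Y/X)² mod
-- every such p and we are done prime by prime.  Otherwise p ∣ X forces p ∣ Y, so p
-- occurs twice in the factorisation and N/p² = (X/p)² + (Y/p)²; the two copies of p
-- contribute the same factor ±1 to each symbol, which cancels, and we conclude by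
-- induction on the number of prime factors.
module Submission where

open import Defs
open import Data.Nat using (ℕ)
open import Data.Nat.GCD using (gcd)
open import Data.Nat.Primality using (Prime)
open import Data.Integer using (ℤ; +_; _+_; _*_; ∣_∣)
open import Data.List using (List)
open import Data.Nat.ListAction using (product)
open import Data.List.Relation.Unary.All using (All)
open import Data.Product using (∃)
open import Relation.Binary.PropositionalEquality using (_≡_)

import Data.Nat as ℕ
import Data.Nat.Properties as ℕ
import Data.Nat.Divisibility as ℕ
open import Data.Nat.Primality
  using (euclidsLemma; prime⇒irreducible; prime⇒nonZero; prime⇒nonTrivial)
open import Data.Nat.Coprimality using (Coprime; coprime-Bézout)
open import Data.Nat.GCD using (module Bézout)
open import Data.Nat.Induction using (<-wellFounded)
open import Data.Nat.ListAction.Properties using (∈⇒∣product)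
open import Data.Integer using (-_; _-_; _^_; 1ℤ)
open import Data.Integer.Properties
  using (abs-*; pos-*; *-comm; *-assoc; *-identityˡ; *-identityʳ; *-cancelˡ-≡; neg-distribˡ-*; ^-distribˡ-+-*)
open import Data.Integer.Divisibility.Signed
  using (_∣_; divides; ∣ᵤ⇒∣; ∣⇒∣ᵤ; ∣m∣n⇒∣m+n; ∣n⇒∣m*n; ∣m⇒∣m*n; m∣∣m∣; _∣?_)
import Algebra.Properties.CommutativeSemigroup as CommutativeSemigroupProperties
open import Data.Integer.Tactic.RingSolver using (solve-∀)
open import Data.List using ([]; _∷_; length)
open import Data.List.Membership.Propositional using (_∈_; _─_; find; lose)
open import Data.List.Properties using (length-removeAt′)
open import Data.List.Relation.Unary.All using ([]; _∷_; lookup; tabulate)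
open import Data.List.Relation.Unary.All.Properties using (─⁺)
open import Data.List.Relation.Unary.Any using (Any; here; there; index; any?)
open import Data.Product using (_,_; _×_; ∃₂)
open import Data.Sum using (_⊎_; inj₁; inj₂; reduce)
import Data.Sum as Sum
open import Function using (id; _∘_; _on_; _⇔_; mk⇔; Equivalence)
open import Induction.WellFounded using (Acc; acc)
import Relation.Binary.Construct.On as On
open import Relation.Nullary using (¬_; Dec; yes; no; contradiction)
open import Relation.Binary.PropositionalEquality
  using (_≢_; refl; sym; trans; cong; cong₂; subst; module ≡-Reasoning)

open Equivalence using (to; from)

module ℕ-* = CommutativeSemigroupProperties ℕ.*-commutativeSemigroup

SumOfTwoSquares : ℤ → Set
SumOfTwoSquares n = ∃₂ λ X Y → n ≡ X * X + Y * Y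

∣-combination : ∀ {d m n k} u v → d ∣ m → d ∣ n → k ≡ u * m + v * n → d ∣ k
∣-combination u v d∣m d∣n refl = ∣m∣n⇒∣m+n (∣n⇒∣m*n u d∣m) (∣n⇒∣m*n v d∣n)

prime∣*⇒∣⊎∣ : ∀ {p} m n → Prime p → + p ∣ m * n → (+ p ∣ m) ⊎ (+ p ∣ n)
prime∣*⇒∣⊎∣ {p} m n pp p∣mn =
  Sum.map ∣ᵤ⇒∣ ∣ᵤ⇒∣ (euclidsLemma ∣ m ∣ ∣ n ∣ pp (subst (p ℕ.∣_) (abs-* m n) (∣⇒∣ᵤ p∣mn)))

prime∣x²+y²∧∣x⇒∣y : ∀ {p} X Y → Prime p → + p ∣ X * X + Y * Y → + p ∣ X → + p ∣ Y
prime∣x²+y²∧∣x⇒∣y X Y pp p∣N p∣X =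
  reduce (prime∣*⇒∣⊎∣ Y Y pp (∣-combination 1ℤ (- X) p∣N p∣X (identity X Y)))
  where
  identity : ∀ X Y → Y * Y ≡ 1ℤ * (X * X + Y * Y) + (- X) * X
  identity = solve-∀

prime∤⇒coprime : ∀ {p m} → Prime p → ¬ p ℕ.∣ m → Coprime m p
prime∤⇒coprime pp p∤m (d∣m , d∣p) with prime⇒irreducible pp d∣p
... | inj₁ d≡1 = d≡1
... | inj₂ refl = contradiction d∣m p∤m

bézout⇒inverse : ∀ {m p} → Bézout.Identity 1 m p → ∃ λ w → + p ∣ + m * w - 1ℤ
bézout⇒inverse {m} {p} (Bézout.+- x y 1+yp≡xm) = + x , divides (+ y) (begin
  + m * + x - 1ℤ         ≡⟨ cong (_- 1ℤ) (*-comm (+ m) (+ x)) ⟩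
  + x * + m - 1ℤ         ≡⟨ cong (_- 1ℤ) (sym (pos-* x m)) ⟩
  + (x ℕ.* m) - 1ℤ       ≡⟨ cong (λ n → + n - 1ℤ) (sym 1+yp≡xm) ⟩
  1ℤ + + (y ℕ.* p) - 1ℤ  ≡⟨ cancel (+ (y ℕ.* p)) ⟩
  + (y ℕ.* p)            ≡⟨ pos-* y p ⟩
  + y * + p              ∎)
  where
  open ≡-Reasoning
  cancel : ∀ n → 1ℤ + n - 1ℤ ≡ n
  cancel = solve-∀
bézout⇒inverse {m} {p} (Bézout.-+ x y 1+xm≡yp) = - + x , divides (- + y) (begin
  + m * - + x - 1ℤ       ≡⟨ negate (+ m) (+ x) ⟩
  - (1ℤ + + x * + m)     ≡⟨ cong (λ n → - (1ℤ + n)) (sym (pos-* x m)) ⟩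
  - + (1 ℕ.+ x ℕ.* m)    ≡⟨ cong (-_ ∘ +_) 1+xm≡yp ⟩
  - + (y ℕ.* p)          ≡⟨ cong -_ (pos-* y p) ⟩
  - (+ y * + p)          ≡⟨ neg-distribˡ-* (+ y) (+ p) ⟩
  - + y * + p            ∎)
  where
  open ≡-Reasoning
  negate : ∀ m x → m * - x - 1ℤ ≡ - (1ℤ + x * m)
  negate = solve-∀

inverse-mod-prime : ∀ {p} X → Prime p → ¬ + p ∣ X → ∃ λ W → + p ∣ X * W - 1ℤ
inverse-mod-prime {p} X pp p∤X =
  let divides c ∣X∣≡cX = m∣∣m∣ {X}
      W , p∣∣X∣W-1     = bézout⇒inverse (coprime-Bézout (prime∤⇒coprime pp (p∤X ∘ ∣ᵤ⇒∣)))
  in  c * W , subst (λ n → + p ∣ n - 1ℤ) (trans (cong (_* W) ∣X∣≡cX) (reassoc c X W)) p∣∣X∣W-1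
  where
  reassoc : ∀ c X W → c * X * W ≡ X * (c * W)
  reassoc = solve-∀

sum-of-squares⇒sqrt[-1] : ∀ {p} X Y → Prime p → + p ∣ X * X + Y * Y → ¬ + p ∣ X →
  ∃ λ i → + p ∣ i * i + 1ℤ
sum-of-squares⇒sqrt[-1] X Y pp p∣N p∤X =
  let W , p∣XW-1 = inverse-mod-prime X pp p∤X in
  Y * W , ∣-combination (W * W) (- (X * W + 1ℤ)) p∣N p∣XW-1 (identity X Y W)
  where
  identity : ∀ X Y W →
    Y * W * (Y * W) + 1ℤ ≡ W * W * (X * X + Y * Y) + - (X * W + 1ℤ) * (X * W - 1ℤ)
  identity = solve-∀

x^2≡x*x : ∀ x → x ^ 2 ≡ x * x
x^2≡x*x x = cong (x *_) (*-identityʳ x)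

x^4≡x^2*x^2 : ∀ x → x ^ 4 ≡ x ^ 2 * x ^ 2
x^4≡x^2*x^2 x = ^-distribˡ-+-* x 2 2

y²-a²≡[y-a][y+a] : ∀ y a → y * y - a * a ≡ (y - a) * (y + a)
y²-a²≡[y-a][y+a] = solve-∀

square⇒quartic : ∀ {p} a → IsPowerResidue 1 p a → IsPowerResidue 2 p (a * a)
square⇒quartic {p} a (x , p∣x²-a) = x , ∣⇒∣ᵤ (subst (+ p ∣_) x²-a∙x²+a≡x⁴-a²
  (∣m⇒∣m*n (x ^ 2 + a) (∣ᵤ⇒∣ {+ p} {x ^ 2 - a} p∣x²-a)))
  where
  x²-a∙x²+a≡x⁴-a² : (x ^ 2 - a) * (x ^ 2 + a) ≡ x ^ 4 - a * a
  x²-a∙x²+a≡x⁴-a² =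
    trans (sym (y²-a²≡[y-a][y+a] (x ^ 2) a)) (cong (_- a * a) (sym (x^4≡x^2*x^2 x)))

squareRoot⇒residue : ∀ {p a} x → + p ∣ x * x - a → IsPowerResidue 1 p a
squareRoot⇒residue {p} {a} x p∣x*x-a =
  x , ∣⇒∣ᵤ (subst (λ y → + p ∣ y - a) (sym (x^2≡x*x x)) p∣x*x-a)

quartic⇒square : ∀ {p} a i → Prime p → + p ∣ i * i + 1ℤ →
  IsPowerResidue 2 p (a * a) → IsPowerResidue 1 p a
quartic⇒square {p} a i pp p∣i²+1 (x , p∣x⁴-a²) =
  root (prime∣*⇒∣⊎∣ (x ^ 2 - a) (x ^ 2 + a) pp (subst (+ p ∣_) x⁴-a²≡[x²-a][x²+a] (∣ᵤ⇒∣ p∣x⁴-a²)))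
  where
  x⁴-a²≡[x²-a][x²+a] : x ^ 4 - a * a ≡ (x ^ 2 - a) * (x ^ 2 + a)
  x⁴-a²≡[x²-a][x²+a] =
    trans (cong (_- a * a) (x^4≡x^2*x^2 x)) (y²-a²≡[y-a][y+a] (x ^ 2) a)
  identity : ∀ i x a → i * x * (i * x) - a ≡ x * x * (i * i + 1ℤ) + - 1ℤ * (x * x + a)
  identity = solve-∀
  root : (+ p ∣ x ^ 2 - a) ⊎ (+ p ∣ x ^ 2 + a) → IsPowerResidue 1 p a
  root (inj₁ p∣x²-a) = x , ∣⇒∣ᵤ p∣x²-a
  root (inj₂ p∣x²+a) = squareRoot⇒residue (i * x) (∣-combination (x * x) (- 1ℤ) p∣i²+1
    (subst (λ y → + p ∣ y + a) (x^2≡x*x x) p∣x²+a) (identity i x a))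

quartic⇔square : ∀ {p} a i → Prime p → + p ∣ i * i + 1ℤ →
  IsPowerResidue 2 p (a * a) ⇔ IsPowerResidue 1 p a
quartic⇔square a i pp p∣i²+1 = mk⇔ (quartic⇒square a i pp p∣i²+1) (square⇒quartic a)

PrimeSymbol-resp-⇔ : ∀ {k l a b p s t} → IsPowerResidue k p a ⇔ IsPowerResidue l p b →
  PrimeSymbol k a p s → PrimeSymbol l b p t → s ≡ t
PrimeSymbol-resp-⇔ _   (inj₁ (_ , s≡1))  (inj₁ (_ , t≡1))  = trans s≡1 (sym t≡1)
PrimeSymbol-resp-⇔ a⇔b (inj₁ (ra , _))   (inj₂ (¬rb , _))  = contradiction (to a⇔b ra) ¬rb
PrimeSymbol-resp-⇔ a⇔b (inj₂ (¬ra , _))  (inj₁ (rb , _))   = contradiction (from a⇔b rb) ¬ra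
PrimeSymbol-resp-⇔ _   (inj₂ (_ , s≡-1)) (inj₂ (_ , t≡-1)) = trans s≡-1 (sym t≡-1)

PrimeSymbol-functional : ∀ {k a p s t} → PrimeSymbol k a p s → PrimeSymbol k a p t → s ≡ t
PrimeSymbol-functional {k} {a} {p} = PrimeSymbol-resp-⇔ {k} {k} {a} {a} {p} (mk⇔ id id)

PrimeSymbol⇒s*s≡1 : ∀ {k a p s} → PrimeSymbol k a p s → s * s ≡ 1ℤ
PrimeSymbol⇒s*s≡1 (inj₁ (_ , refl)) = refl
PrimeSymbol⇒s*s≡1 (inj₂ (_ , refl)) = refl

Symbol-resp-⇔ : ∀ {k l a b s t} ps → All (λ p → IsPowerResidue k p a ⇔ IsPowerResidue l p b) ps →
  Symbol k a ps s → Symbol l b ps t → s ≡ t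
Symbol-resp-⇔ []       []           s≡1 t≡1 = trans s≡1 (sym t≡1)
Symbol-resp-⇔ {k} {l} {a} {b} (p ∷ ps) (a⇔b ∷ a⇔bs)
  (_ , _ , Sp , Sps , refl) (_ , _ , Tp , Tps , refl) =
  cong₂ _*_ (PrimeSymbol-resp-⇔ {k} {l} {a} {b} a⇔b Sp Tp) (Symbol-resp-⇔ ps a⇔bs Sps Tps)

Symbol-─ : ∀ {k a p s} ps (p∈ps : p ∈ ps) → Symbol k a ps s →
  ∃₂ λ sp s′ → PrimeSymbol k a p sp × Symbol k a (ps ─ p∈ps) s′ × s ≡ sp * s′
Symbol-─ (q ∷ qs) (here refl) S = S
Symbol-─ (q ∷ qs) (there p∈qs) (sq , _ , Sq , Sqs , refl)
  with sp , s′ , Sp , S′ , refl ← Symbol-─ qs p∈qs Sqs =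
  sp , sq * s′ , Sp , (sq , s′ , Sq , S′ , refl) , x*[y*z]≡y*[x*z] sq sp s′
  where
  x*[y*z]≡y*[x*z] : ∀ x y z → x * (y * z) ≡ y * (x * z)
  x*[y*z]≡y*[x*z] = solve-∀

Symbol-── : ∀ {k a p s} ps (p∈ps : p ∈ ps) (p∈ps′ : p ∈ ps ─ p∈ps) →
  Symbol k a ps s → Symbol k a ((ps ─ p∈ps) ─ p∈ps′) s
Symbol-── {k} {a} {p} {s} ps p∈ps p∈ps′ S
  with sp , s′ , Sp , S′ , s≡sp*s′ ← Symbol-─ ps p∈ps S
  with sp′ , s″ , Sp′ , S″ , s′≡sp′*s″ ← Symbol-─ (ps ─ p∈ps) p∈ps′ S′ =
  subst (Symbol _ _ _) (sym s≡s″) S″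
  where
  open ≡-Reasoning
  s≡s″ : s ≡ s″
  s≡s″ = begin
    s                ≡⟨ s≡sp*s′ ⟩
    sp * s′          ≡⟨ cong (sp *_) s′≡sp′*s″ ⟩
    sp * (sp′ * s″)  ≡⟨ cong (λ t → sp * (t * s″)) (PrimeSymbol-functional {k} {a} {p} Sp′ Sp) ⟩
    sp * (sp * s″)   ≡⟨ sym (*-assoc sp sp s″) ⟩
    sp * sp * s″     ≡⟨ cong (_* s″) (PrimeSymbol⇒s*s≡1 {k} {a} {p} Sp) ⟩
    1ℤ * s″          ≡⟨ *-identityˡ s″ ⟩
    s″               ∎

product-─ : ∀ {p} ps (p∈ps : p ∈ ps) → product ps ≡ p ℕ.* product (ps ─ p∈ps)
product-─ (q ∷ qs) (here refl) = refl
product-─ {p} (q ∷ qs) (there p∈qs) =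
  trans (cong (q ℕ.*_) (product-─ qs p∈qs)) (ℕ-*.x∙yz≈y∙xz q p (product (qs ─ p∈qs)))

prime≢1 : ∀ {p} → Prime p → p ≢ 1
prime≢1 pp = ℕ.nonTrivial⇒≢1 {{prime⇒nonTrivial pp}}

prime∣product⇒∈ : ∀ {p} ps → Prime p → All Prime ps → p ℕ.∣ product ps → p ∈ ps
prime∣product⇒∈ []       pp []         p∣1  = contradiction (ℕ.∣1⇒≡1 p∣1) (prime≢1 pp)
prime∣product⇒∈ (q ∷ qs) pp (pq ∷ pqs) p∣qQ with euclidsLemma q (product qs) pp p∣qQ
... | inj₂ p∣Q = there (prime∣product⇒∈ qs pp pqs p∣Q)
... | inj₁ p∣q with prime⇒irreducible pq p∣q
...   | inj₁ p≡1 = contradiction p≡1 (prime≢1 pp)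
...   | inj₂ p≡q = here p≡q

length-─ : ∀ {A : Set} {x : A} xs (x∈xs : x ∈ xs) → length (xs ─ x∈xs) ℕ.< length xs
length-─ xs x∈xs = ℕ.≤-reflexive (sym (length-removeAt′ xs (index x∈xs)))

pos-*-cancelˡ : ∀ p {m} z .{{_ : ℕ.NonZero p}} → + (p ℕ.* m) ≡ + p * z → + m ≡ z
pos-*-cancelˡ p {m} z eq = *-cancelˡ-≡ (+ p) (+ m) z (trans (sym (pos-* p m)) eq)

descent : ∀ {p X Y} ps → All Prime ps → (p∈ps : p ∈ ps) →
  + product ps ≡ X * X + Y * Y → + p ∣ X →
  ∃ λ (p∈ps′ : p ∈ ps ─ p∈ps) → SumOfTwoSquares (+ product ((ps ─ p∈ps) ─ p∈ps′))
descent {p} {X} {Y} ps primes p∈ps N≡X²+Y² p∣X =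
  p∈ps′ , X′ , Y′ , pos-*-cancelˡ p Q (trans (cong +_ (sym (product-─ ps′ p∈ps′))) M≡pQ)
  where
  open ≡-Reasoning
  pp : Prime p
  pp = lookup primes p∈ps
  instance
    p≢0 : ℕ.NonZero p
    p≢0 = prime⇒nonZero pp
  ps′ : List ℕ
  ps′ = ps ─ p∈ps
  p∣N : + p ∣ X * X + Y * Y
  p∣N = subst (+ p ∣_) N≡X²+Y² (∣ᵤ⇒∣ (∈⇒∣product p∈ps))
  open _∣_ p∣X renaming (quotient to X′; equality to X≡X′p)
  open _∣_ (prime∣x²+y²∧∣x⇒∣y X Y pp p∣N p∣X) renaming (quotient to Y′; equality to Y≡Y′p)
  Q : ℤ
  Q = X′ * X′ + Y′ * Y′
  identity : ∀ x y p → x * p * (x * p) + y * p * (y * p) ≡ p * (p * (x * x + y * y))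
  identity = solve-∀
  M≡pQ : + product ps′ ≡ + p * Q
  M≡pQ = pos-*-cancelˡ p (+ p * Q) (begin
    + (p ℕ.* product ps′)                          ≡⟨ cong +_ (sym (product-─ ps p∈ps)) ⟩
    + product ps                                   ≡⟨ N≡X²+Y² ⟩
    X * X + Y * Y                                  ≡⟨ cong₂ (λ x y → x * x + y * y) X≡X′p Y≡Y′p ⟩
    X′ * + p * (X′ * + p) + Y′ * + p * (Y′ * + p)  ≡⟨ identity X′ Y′ (+ p) ⟩
    + p * (+ p * Q)                                ∎)
  p∈ps′ : p ∈ ps′
  p∈ps′ = prime∣product⇒∈ ps′ pp (─⁺ p∈ps primes) (∣⇒∣ᵤ (divides Q (trans M≡pQ (*-comm (+ p) Q))))

quarticSymbol≡squareSymbol : ∀ a ps → Acc (ℕ._<_ on length) ps → All Prime ps →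
  SumOfTwoSquares (+ product ps) → ∀ s t → Symbol 2 (a * a) ps s → Symbol 1 a ps t → s ≡ t
quarticSymbol≡squareSymbol a ps (acc shorter) primes (X , Y , N≡X²+Y²) s t S T =
  agree (any? (λ p → + p ∣? X) ps)
  where
  p∣X²+Y² : ∀ {p} → p ∈ ps → + p ∣ X * X + Y * Y
  p∣X²+Y² p∈ps = subst (_ ∣_) N≡X²+Y² (∣ᵤ⇒∣ (∈⇒∣product p∈ps))
  quartic⇔square-at : ∀ {p} → ¬ Any (λ q → + q ∣ X) ps → p ∈ ps →
    IsPowerResidue 2 p (a * a) ⇔ IsPowerResidue 1 p a
  quartic⇔square-at ∄p∣X p∈ps =
    let pp = lookup primes p∈ps
        i , p∣i²+1 = sum-of-squares⇒sqrt[-1] X Y pp (p∣X²+Y² p∈ps) (∄p∣X ∘ lose p∈ps)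
    in  quartic⇔square a i pp p∣i²+1
  agree : Dec (Any (λ p → + p ∣ X) ps) → s ≡ t
  agree (no ∄p∣X)  = Symbol-resp-⇔ ps (tabulate (quartic⇔square-at ∄p∣X)) S T
  agree (yes ∃p∣X) =
    let p , p∈ps , p∣X = find ∃p∣X
        p∈ps′ , sum = descent {X = X} {Y = Y} ps primes p∈ps N≡X²+Y² p∣X
    in  quarticSymbol≡squareSymbol a ((ps ─ p∈ps) ─ p∈ps′)
          (shorter (ℕ.<-trans (length-─ (ps ─ p∈ps) p∈ps′) (length-─ ps p∈ps)))
          (─⁺ p∈ps′ (─⁺ p∈ps primes)) sum s t
          (Symbol-── ps p∈ps p∈ps′ S) (Symbol-── ps p∈ps p∈ps′ T)

lemma6 : (N : ℕ) (a : ℤ) → gcd N ∣ a ∣ ≡ 1 →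
    (∃ λ (X : ℤ) → ∃ λ (Y : ℤ) → + N ≡ X * X + Y * Y) →
    (ps : List ℕ) → All Prime ps → product ps ≡ N →
    (s t : ℤ) → Symbol 2 (a * a) ps s → Symbol 1 a ps t → s ≡ t
lemma6 N a _ N-sum ps primes refl =
  quarticSymbol≡squareSymbol a ps (On.wellFounded length <-wellFounded ps) primes N-sum
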